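{- Let $H$ be a $2$-regular class 2 graph whose shortest odd cycle has length $m$. Then $\mathrm{cms}(H) \leq \frac{m-1}{2m}|E(H)|$.
   Context: All graphs are finite and simple. A $2$-regular graph is class 2 if its edges cannot be properly coloured with $2$ colours (equivalently, it has an odd cycle). An ordering of a graph $G$ with $m'$ edges is a bijection $\ell:E(G)\to\mathbb{Z}_{m'}$; $d_\ell(e,e')$ is the smallest positive integer $d$ with $\ell(e)+d=\ell(e')$, $d_\ell\{e,e'\}=\min\{d_\ell(e,e'),d_\ell(e',e)\}$; $\mathrm{cms}(\ell)$ is the largest $s\in\{1,\dots,m'\}$ with $d_\ell\{e,e'\}\geq s$ for every pair of edges sharing a vertex, and $\mathrm{cms}(G)$ is the maximum of $\mathrm{cms}(\ell)$ over all orderings of $G$. -}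

module Defs where

import Data.Nat
open import Data.Nat using (ℕ; zero; suc; _+_; _*_; _∸_; _≤_; _<_; _≤ᵇ_)
import Data.Nat.Properties
import Data.Nat.DivMod
import Data.Fin
open import Data.Fin using (Fin; toℕ) renaming (suc to fsuc; zero to fzero)
open import Data.Fin.Properties using () renaming (_≟_ to _≟ᶠ_)
open import Data.Product using (Σ; ∃; ∃-syntax; _×_; _,_; proj₁; proj₂)
open import Data.Sum using (_⊎_)
open import Data.Bool using (Bool; if_then_else_)
open import Data.List using (List; length; filter; allFin)
open import Relation.Nullary using (¬_)
open import Relation.Nullary.Decidable using (_⊎-dec_)
open import Relation.Binary.PropositionalEquality using (_≡_; _≢_)
open import Function.Definitions using (Injective; Bijective)

-- Each edge {u,v} is stored as (u , v) with u < v (no loops, canonical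
-- orientation) and distinct indices give distinct edges (no multi-edges).
record Graph : Set where
  field
    n     : ℕ
    m'    : ℕ
    edge  : Fin m' → Fin n × Fin n
    loopless-canonical : ∀ e → toℕ (proj₁ (edge e)) < toℕ (proj₂ (edge e))
    no-multi : Injective _≡_ _≡_ edge

module _ (G : Graph) where
  open Graph G

  Incident : Fin n → Fin m' → Set
  Incident v e = v ≡ proj₁ (edge e) ⊎ v ≡ proj₂ (edge e)

  degree : Fin n → ℕ
  degree v = length (filter (λ e → (v ≟ᶠ proj₁ (edge e)) ⊎-dec (v ≟ᶠ proj₂ (edge e))) (allFin m'))

  TwoRegular : Set
  TwoRegular = ∀ v → degree v ≡ 2

  SharesVertex : Fin m' → Fin m' → Set
  SharesVertex e e' = e ≢ e' × ∃[ v ] (Incident v e × Incident v e')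

  Proper2EdgeColouring : (Fin m' → Bool) → Set
  Proper2EdgeColouring c = ∀ e e' → SharesVertex e e' → c e ≢ c e'

  -- class 2 (for a 2-regular graph): not properly 2-edge-colourable
  Class2 : Set
  Class2 = ¬ (Σ (Fin m' → Bool) Proper2EdgeColouring)

  Adjacent : Fin n → Fin n → Set
  Adjacent u v = ∃[ e ] (edge e ≡ (u , v) ⊎ edge e ≡ (v , u))

  next : ∀ {k} → Fin k → Fin k
  next {suc k} i = Data.Fin.fromℕ< (Data.Nat.DivMod.m%n<n (suc (toℕ i)) (suc k))

  Cycle : ℕ → Set
  Cycle k = 3 ≤ k × Σ (Fin k → Fin n) λ f → Injective _≡_ _≡_ f × (∀ i → Adjacent (f i) (f (next i)))

  Odd : ℕ → Set
  Odd k = ∃[ j ] k ≡ suc (2 * j)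

  ShortestOddCycle : ℕ → Set
  ShortestOddCycle m = (Odd m × Cycle m) × (∀ k → Odd k → Cycle k → m ≤ k)

  -- orderings: bijections E(G) → ℤ_{m'} (ℤ_{m'} represented by Fin m')
  Ordering : Set
  Ordering = Σ (Fin m' → Fin m') (Bijective _≡_ _≡_)

  -- d_ℓ(e,e') : smallest positive d with ℓ(e) + d ≡ ℓ(e') (mod m')
  dist : Ordering → Fin m' → Fin m' → ℕ
  dist (ℓ , _) e e' = if toℕ (ℓ e) Data.Nat.<ᵇ toℕ (ℓ e')
                        then toℕ (ℓ e') ∸ toℕ (ℓ e)
                        else (m' + toℕ (ℓ e')) ∸ toℕ (ℓ e)

  symDist : Ordering → Fin m' → Fin m' → ℕ
  symDist ℓ e e' = dist ℓ e e' Data.Nat.⊓ dist ℓ e' e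

  Separated : Ordering → ℕ → Set
  Separated ℓ s = ∀ e e' → SharesVertex e e' → s ≤ symDist ℓ e e'

  IsCms : Ordering → ℕ → Set
  IsCms ℓ s = (1 ≤ s × s ≤ m') × Separated ℓ s
              × (∀ t → 1 ≤ t → t ≤ m' → Separated ℓ t → t ≤ s)

-- Walk once around an odd cycle e₀, …, e_{m-1} of H.  Consecutive edges share a vertex, so
-- the forward gap δᵢ from ℓ(eᵢ) to ℓ(eᵢ₊₁) on ℤ_{m'} satisfies s ≤ δᵢ and s ≤ m' − δᵢ.
-- Going round the cycle the gaps add up to W·m' for an integer winding number W, hence
-- m·s ≤ W·m' ≤ m·m' − m·s.  Since m = 2j+1 is odd, either W ≤ j, or m − W ≤ j; in both cases
-- m·s ≤ j·m'.

module Submission where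

open import Data.Bool using (true; false; if_then_else_)
open import Data.Empty using (⊥-elim)
open import Data.Fin using (Fin; toℕ)
open import Data.Fin.Properties using (toℕ-injective; toℕ-fromℕ<; toℕ<n)
open import Data.Nat using (ℕ; zero; suc; _+_; _*_; _∸_; _≤_; _<_; _<ᵇ_; _⊓_; z≤n; s≤s; NonZero)
open import Data.Nat.DivMod
  using (_%_; _mod_; %-distribˡ-+; m%n%n≡m%n; m<n⇒m%n≡m; m≤n⇒[n∸m]%m≡n%m; n%n≡0)
open import Data.Nat.Properties
open import Data.Nat.Tactic.RingSolver using (solve-∀)
open import Data.Product using (∃-syntax; _×_; _,_; proj₁; proj₂)
open import Data.Sum using (inj₁; inj₂)
open import Function.Base using (_∘_)
open import Function.Definitions using (Injective)
open import Relation.Nullary using (¬_; yes; no)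
open import Relation.Nullary.Reflects using (ofʸ; ofⁿ)
open import Relation.Binary using (tri<; tri≈; tri>)
open import Relation.Binary.PropositionalEquality
  using (_≡_; _≢_; refl; sym; trans; cong; cong₂; subst; module ≡-Reasoning)

open import Defs

-- dist G ℓ e e' is definitionally gap (ℓ e) (ℓ e'); note that gap x x ≡ M.
gap : ∀ {M} → Fin M → Fin M → ℕ
gap {M} x y = if toℕ x <ᵇ toℕ y then toℕ y ∸ toℕ x else (M + toℕ y) ∸ toℕ x

gap-< : ∀ {M} (x y : Fin M) → toℕ x < toℕ y → gap x y ≡ toℕ y ∸ toℕ x
gap-< x y x<y with toℕ x <ᵇ toℕ y | <ᵇ-reflects-< (toℕ x) (toℕ y)
... | true  | _        = refl
... | false | ofⁿ x≮y = ⊥-elim (x≮y x<y)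

gap-≥ : ∀ {M} (x y : Fin M) → toℕ y ≤ toℕ x → gap x y ≡ (M + toℕ y) ∸ toℕ x
gap-≥ x y y≤x with toℕ x <ᵇ toℕ y | <ᵇ-reflects-< (toℕ x) (toℕ y)
... | true  | ofʸ x<y = ⊥-elim (<⇒≱ x<y y≤x)
... | false | _        = refl

gap-winds : ∀ {M} (x y : Fin M) → ∃[ w ] toℕ x + gap x y ≡ toℕ y + w * M
gap-winds {M} x y with toℕ x <? toℕ y
... | yes x<y = 0 , (begin
  toℕ x + gap x y           ≡⟨ cong (toℕ x +_) (gap-< x y x<y) ⟩
  toℕ x + (toℕ y ∸ toℕ x)   ≡⟨ m+[n∸m]≡n (<⇒≤ x<y) ⟩
  toℕ y                     ≡⟨ +-identityʳ (toℕ y) ⟨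
  toℕ y + 0 * M             ∎)
  where open ≡-Reasoning
... | no x≮y = 1 , (begin
  toℕ x + gap x y               ≡⟨ cong (toℕ x +_) (gap-≥ x y (≮⇒≥ x≮y)) ⟩
  toℕ x + ((M + toℕ y) ∸ toℕ x) ≡⟨ m+[n∸m]≡n x≤M+y ⟩
  M + toℕ y                     ≡⟨ +-comm M (toℕ y) ⟩
  toℕ y + M                     ≡⟨ cong (toℕ y +_) (*-identityˡ M) ⟨
  toℕ y + 1 * M                 ∎)
  where
  open ≡-Reasoning
  x≤M+y : toℕ x ≤ M + toℕ y
  x≤M+y = ≤-trans (<⇒≤ (toℕ<n x)) (m≤m+n M (toℕ y))

[n∸m]+[o+m∸n]≡o : ∀ {m n} o → m ≤ n → n ≤ o + m → (n ∸ m) + (o + m ∸ n) ≡ o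
[n∸m]+[o+m∸n]≡o {m} {n} o m≤n n≤o+m = +-cancelˡ-≡ m _ _ (begin
  m + ((n ∸ m) + (o + m ∸ n)) ≡⟨ +-assoc m (n ∸ m) _ ⟨
  (m + (n ∸ m)) + (o + m ∸ n) ≡⟨ cong (_+ (o + m ∸ n)) (m+[n∸m]≡n m≤n) ⟩
  n + (o + m ∸ n)             ≡⟨ m+[n∸m]≡n n≤o+m ⟩
  o + m                       ≡⟨ +-comm o m ⟩
  m + o                       ∎)
  where open ≡-Reasoning

gap-+-gap-< : ∀ {M} (x y : Fin M) → toℕ x < toℕ y → gap x y + gap y x ≡ M
gap-+-gap-< {M} x y x<y = trans (cong₂ _+_ (gap-< x y x<y) (gap-≥ y x (<⇒≤ x<y)))
  ([n∸m]+[o+m∸n]≡o M (<⇒≤ x<y) (≤-trans (<⇒≤ (toℕ<n y)) (m≤m+n M (toℕ x))))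

gap-+-gap : ∀ {M} (x y : Fin M) → x ≢ y → gap x y + gap y x ≡ M
gap-+-gap x y x≢y with <-cmp (toℕ x) (toℕ y)
... | tri< x<y _ _ = gap-+-gap-< x y x<y
... | tri≈ _ x≡y _ = ⊥-elim (x≢y (toℕ-injective x≡y))
... | tri> _ _ y<x = trans (+-comm (gap x y) (gap y x)) (gap-+-gap-< y x y<x)

cyclicDist : ∀ {M} → Fin M → Fin M → ℕ
cyclicDist x y = gap x y ⊓ gap y x

sumTo : ℕ → (ℕ → ℕ) → ℕ
sumTo zero    f = 0
sumTo (suc k) f = sumTo k f + f k

sumTo-mono-≤ : ∀ k {f g} → (∀ i → i < k → f i ≤ g i) → sumTo k f ≤ sumTo k g
sumTo-mono-≤ zero    f≤g = z≤n
sumTo-mono-≤ (suc k) f≤g =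
  +-mono-≤ (sumTo-mono-≤ k (λ i i<k → f≤g i (m<n⇒m<1+n i<k))) (f≤g k (n<1+n k))

sumTo-const : ∀ k c → sumTo k (λ _ → c) ≡ k * c
sumTo-const zero    c = refl
sumTo-const (suc k) c = trans (cong (_+ c) (sumTo-const k c)) (+-comm (k * c) c)

sumTo-+ : ∀ k f g → sumTo k (λ i → f i + g i) ≡ sumTo k f + sumTo k g
sumTo-+ zero    f g = refl
sumTo-+ (suc k) f g = trans (cong (_+ (f k + g k)) (sumTo-+ k f g))
                            (interchange (sumTo k f) (sumTo k g) (f k) (g k))
  where
  interchange : ∀ a b c d → (a + b) + (c + d) ≡ (a + c) + (b + d)
  interchange = solve-∀

module _ {M : ℕ} (x : ℕ → Fin M) where

  gapSum : ℕ → ℕ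
  gapSum k = sumTo k (λ i → gap (x i) (x (suc i)))

  gapSum-winds : ∀ k → ∃[ W ] toℕ (x 0) + gapSum k ≡ toℕ (x k) + W * M
  gapSum-winds zero    = 0 , refl
  gapSum-winds (suc k) with gapSum-winds k | gap-winds (x k) (x (suc k))
  ... | W , x₀+S≡xₖ+WM | w , xₖ+δ≡xₖ₊₁+wM = w + W , (begin
    x₀ + (gapSum k + δ)   ≡⟨ +-assoc x₀ (gapSum k) δ ⟨
    (x₀ + gapSum k) + δ   ≡⟨ cong (_+ δ) x₀+S≡xₖ+WM ⟩
    (xₖ + W * M) + δ      ≡⟨ swap xₖ (W * M) δ ⟩
    (xₖ + δ) + W * M      ≡⟨ cong (_+ W * M) xₖ+δ≡xₖ₊₁+wM ⟩
    (xₖ₊₁ + w * M) + W * M ≡⟨ collect xₖ₊₁ w W M ⟩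
    xₖ₊₁ + (w + W) * M    ∎)
    where
    open ≡-Reasoning
    x₀ xₖ xₖ₊₁ δ : ℕ
    x₀ = toℕ (x 0)
    xₖ = toℕ (x k)
    xₖ₊₁ = toℕ (x (suc k))
    δ = gap (x k) (x (suc k))
    swap : ∀ a b c → (a + b) + c ≡ (a + c) + b
    swap = solve-∀
    collect : ∀ a w W M → (a + w * M) + W * M ≡ a + (w + W) * M
    collect = solve-∀

  closed-gapSum : ∀ k → x k ≡ x 0 → ∃[ W ] gapSum k ≡ W * M
  closed-gapSum k xₖ≡x₀ with gapSum-winds k
  ... | W , x₀+S≡xₖ+WM =
    W , +-cancelˡ-≡ (toℕ (x 0)) _ _ (trans x₀+S≡xₖ+WM (cong (λ y → toℕ y + W * M) xₖ≡x₀))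

  module _ (k s : ℕ) (sep : ∀ i → i < k → s ≤ cyclicDist (x i) (x (suc i))) where

    gapSum-≥ : k * s ≤ gapSum k
    gapSum-≥ = begin
      k * s                  ≡⟨ sumTo-const k s ⟨
      sumTo k (λ _ → s)      ≤⟨ sumTo-mono-≤ k (λ i i<k → m≤n⊓o⇒m≤n _ _ (sep i i<k)) ⟩
      gapSum k               ∎
      where open ≤-Reasoning

    gapSum-+-≤ : (∀ i → i < k → x i ≢ x (suc i)) → gapSum k + k * s ≤ k * M
    gapSum-+-≤ distinct = begin
      gapSum k + k * s                           ≡⟨ cong (gapSum k +_) (sumTo-const k s) ⟨
      gapSum k + sumTo k (λ _ → s)               ≡⟨ sumTo-+ k _ _ ⟨
      sumTo k (λ i → gap (x i) (x (suc i)) + s)  ≤⟨ sumTo-mono-≤ k gap+s≤M ⟩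
      sumTo k (λ _ → M)                          ≡⟨ sumTo-const k M ⟩
      k * M                                      ∎
      where
      open ≤-Reasoning
      gap+s≤M : ∀ i → i < k → gap (x i) (x (suc i)) + s ≤ M
      gap+s≤M i i<k = ≤-trans (+-monoʳ-≤ (gap (x i) (x (suc i))) (m≤n⊓o⇒m≤o _ _ (sep i i<k)))
                              (≤-reflexive (gap-+-gap (x i) (x (suc i)) (distinct i i<k)))

odd-winding-bound : ∀ j s W M →
  suc (2 * j) * s ≤ W * M → W * M + suc (2 * j) * s ≤ suc (2 * j) * M → suc (2 * j) * s ≤ j * M
odd-winding-bound j s W M ks≤WM WM+ks≤kM with W ≤? j
... | yes W≤j = ≤-trans ks≤WM (*-monoˡ-≤ M W≤j)
... | no  W≰j = +-cancelˡ-≤ (suc j * M) _ _ (begin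
  suc j * M + suc (2 * j) * s  ≤⟨ +-monoˡ-≤ _ (*-monoˡ-≤ M (≰⇒> W≰j)) ⟩
  W * M + suc (2 * j) * s      ≤⟨ WM+ks≤kM ⟩
  suc (2 * j) * M              ≡⟨ split j M ⟩
  suc j * M + j * M            ∎)
  where
  open ≤-Reasoning
  split : ∀ j M → suc (2 * j) * M ≡ suc j * M + j * M
  split = solve-∀

odd-closed-sequence-bound : ∀ {M} (x : ℕ → Fin M) j s → x (suc (2 * j)) ≡ x 0 →
  (∀ i → i < suc (2 * j) → x i ≢ x (suc i)) →
  (∀ i → i < suc (2 * j) → s ≤ cyclicDist (x i) (x (suc i))) →
  2 * suc (2 * j) * s ≤ 2 * j * M
odd-closed-sequence-bound {M} x j s closed distinct sep with closed-gapSum x (suc (2 * j)) closed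
... | W , S≡WM = begin
  2 * suc (2 * j) * s    ≡⟨ *-assoc 2 (suc (2 * j)) s ⟩
  2 * (suc (2 * j) * s)  ≤⟨ *-monoʳ-≤ 2 (odd-winding-bound j s W M lower upper) ⟩
  2 * (j * M)            ≡⟨ *-assoc 2 j M ⟨
  2 * j * M              ∎
  where
  open ≤-Reasoning
  k : ℕ
  k = suc (2 * j)
  lower : k * s ≤ W * M
  lower = ≤-trans (gapSum-≥ x k s sep) (≤-reflexive S≡WM)
  upper : W * M + k * s ≤ k * M
  upper = ≤-trans (≤-reflexive (cong (_+ k * s) (sym S≡WM))) (gapSum-+-≤ x k s sep distinct)

[1+m%d]%d≡[1+m]%d : ∀ m d .{{_ : NonZero d}} → suc (m % d) % d ≡ suc m % d
[1+m%d]%d≡[1+m]%d m d = begin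
  (1 + m % d) % d            ≡⟨ %-distribˡ-+ 1 (m % d) d ⟩
  (1 % d + m % d % d) % d    ≡⟨ cong (λ r → (1 % d + r) % d) (m%n%n≡m%n m d) ⟩
  (1 % d + m % d) % d        ≡⟨ %-distribˡ-+ 1 m d ⟨
  (1 + m) % d                ∎
  where open ≡-Reasoning

[c+x]%d≢x : ∀ {c x d} .{{_ : NonZero d}} → 0 < c → c < d → x < d → (c + x) % d ≢ x
[c+x]%d≢x {c} {x} {d} 0<c c<d x<d eq with c + x <? d
... | yes c+x<d = <⇒≢ (m<n+m x 0<c) (sym (trans (sym (m<n⇒m%n≡m c+x<d)) eq))
... | no  c+x≮d = <⇒≢ c<d (+-cancelʳ-≡ x c d (begin
  c + x            ≡⟨ m∸n+n≡m d≤c+x ⟨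
  (c + x ∸ d) + d  ≡⟨ cong (_+ d) wrapped≡x ⟩
  x + d            ≡⟨ +-comm x d ⟩
  d + x            ∎))
  where
  open ≡-Reasoning
  d≤c+x : d ≤ c + x
  d≤c+x = ≮⇒≥ c+x≮d
  wrapped<d : c + x ∸ d < d
  wrapped<d = subst (c + x ∸ d <_) (m+n∸n≡m d d) (∸-monoˡ-< (+-mono-< c<d x<d) d≤c+x)
  wrapped≡x : c + x ∸ d ≡ x
  wrapped≡x = trans (sym (m<n⇒m%n≡m wrapped<d)) (trans (m≤n⇒[n∸m]%m≡n%m d≤c+x) eq)

module _ (G : Graph) where
  open Graph G

  next-mod : ∀ k i → next G (i mod suc k) ≡ suc i mod suc k
  next-mod k i = toℕ-injective (begin
    toℕ (next G (i mod suc k))        ≡⟨ toℕ-fromℕ< _ ⟩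
    suc (toℕ (i mod suc k)) % suc k   ≡⟨ cong (λ r → suc r % suc k) (toℕ-fromℕ< _) ⟩
    suc (i % suc k) % suc k           ≡⟨ [1+m%d]%d≡[1+m]%d i (suc k) ⟩
    suc i % suc k                     ≡⟨ toℕ-fromℕ< _ ⟨
    toℕ (suc i mod suc k)             ∎)
    where open ≡-Reasoning

  next-≢ : ∀ {k} → 1 ≤ k → (j : Fin (suc k)) → j ≢ next G j
  next-≢ 1≤k j j≡next = [c+x]%d≢x (s≤s z≤n) (s≤s 1≤k) (toℕ<n j)
    (sym (trans (cong toℕ j≡next) (toℕ-fromℕ< _)))

  next²-≢ : ∀ {k} → 2 ≤ k → (j : Fin (suc k)) → j ≢ next G (next G j)
  next²-≢ {k} 2≤k j j≡next² = [c+x]%d≢x (s≤s z≤n) (s≤s 2≤k) (toℕ<n j) (sym (begin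
    toℕ j                                  ≡⟨ cong toℕ j≡next² ⟩
    toℕ (next G (next G j))                ≡⟨ toℕ-fromℕ< _ ⟩
    suc (toℕ (next G j)) % suc k           ≡⟨ cong (λ r → suc r % suc k) (toℕ-fromℕ< _) ⟩
    suc (suc (toℕ j) % suc k) % suc k      ≡⟨ [1+m%d]%d≡[1+m]%d (suc (toℕ j)) (suc k) ⟩
    (2 + toℕ j) % suc k                    ∎))
    where open ≡-Reasoning

  adjacent-incident : ∀ {u v} (p : Adjacent G u v) →
    Incident G u (proj₁ p) × Incident G v (proj₁ p)
  adjacent-incident (e , inj₁ e≡uv) = inj₁ (cong proj₁ (sym e≡uv)) , inj₂ (cong proj₂ (sym e≡uv))
  adjacent-incident (e , inj₂ e≡vu) = inj₂ (cong proj₂ (sym e≡vu)) , inj₁ (cong proj₁ (sym e≡vu))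

  edge-has-two-endpoints : ∀ {u v w e} → u ≢ v → v ≢ w → u ≢ w →
    Incident G u e → Incident G v e → ¬ Incident G w e
  edge-has-two-endpoints u≢v _   _   (inj₁ refl) (inj₁ refl) _           = u≢v refl
  edge-has-two-endpoints u≢v _   _   (inj₂ refl) (inj₂ refl) _           = u≢v refl
  edge-has-two-endpoints _   _   u≢w (inj₁ refl) (inj₂ refl) (inj₁ refl) = u≢w refl
  edge-has-two-endpoints _   v≢w _   (inj₁ refl) (inj₂ refl) (inj₂ refl) = v≢w refl
  edge-has-two-endpoints _   v≢w _   (inj₂ refl) (inj₁ refl) (inj₁ refl) = v≢w refl
  edge-has-two-endpoints _   _   u≢w (inj₂ refl) (inj₁ refl) (inj₂ refl) = u≢w refl

  module CycleWalk {k} (2≤k : 2 ≤ k) (f : Fin (suc k) → Fin n) (f-inj : Injective _≡_ _≡_ f)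
                   (adj : ∀ j → Adjacent G (f j) (f (next G j))) where

    cycleEdge : Fin (suc k) → Fin m'
    cycleEdge j = proj₁ (adj j)

    cycleEdge-shares : ∀ j → SharesVertex G (cycleEdge j) (cycleEdge (next G j))
    cycleEdge-shares j = cycleEdge-≢ , f (next G j) , proj₂ (ends j) , proj₁ (ends (next G j))
      where
      1≤k : 1 ≤ k
      1≤k = ≤-trans (s≤s z≤n) 2≤k
      ends : ∀ j → Incident G (f j) (cycleEdge j) × Incident G (f (next G j)) (cycleEdge j)
      ends j = adjacent-incident (adj j)
      cycleEdge-≢ : cycleEdge j ≢ cycleEdge (next G j)
      cycleEdge-≢ same = edge-has-two-endpoints
        (next-≢ 1≤k j ∘ f-inj)
        (next-≢ 1≤k (next G j) ∘ f-inj)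
        (next²-≢ 2≤k j ∘ f-inj)
        (proj₁ (ends j)) (proj₂ (ends j))
        (subst (Incident G _) (sym same) (proj₂ (ends (next G j))))

    walk : ℕ → Fin m'
    walk i = cycleEdge (i mod suc k)

    walk-shares : ∀ i → SharesVertex G (walk i) (walk (suc i))
    walk-shares i = subst (λ j → SharesVertex G (walk i) (cycleEdge j)) (next-mod k i)
                          (cycleEdge-shares (i mod suc k))

    walk-closed : walk (suc k) ≡ walk 0
    walk-closed = cong cycleEdge (toℕ-injective (trans (toℕ-fromℕ< _) (n%n≡0 (suc k))))

  oddCycle-separation-bound : ∀ j → Cycle G (suc (2 * j)) →
    (ℓ : Ordering G) (s : ℕ) → Separated G ℓ s → 2 * suc (2 * j) * s ≤ 2 * j * m'
  oddCycle-separation-bound j (s≤s 2≤2j , f , f-inj , adj) (L , L-bij) s sep =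
    odd-closed-sequence-bound (L ∘ walk) j s (cong L walk-closed)
      (λ i _ → proj₁ (walk-shares i) ∘ proj₁ L-bij)
      (λ i _ → sep (walk i) (walk (suc i)) (walk-shares i))
    where open CycleWalk 2≤2j f f-inj adj

corollary3p6 : (H : Graph) → TwoRegular H → Class2 H →
    (m : ℕ) → ShortestOddCycle H m →
    (ℓ : Ordering H) (s : ℕ) → IsCms H ℓ s →
    2 * m * s ≤ (m ∸ 1) * Graph.m' H
corollary3p6 H _ _ .(suc (2 * j)) (((j , refl) , oddCycle) , _) ℓ s (_ , separated , _) =
  oddCycle-separation-bound H j oddCycle ℓ s separated
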